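{- Let $0\le a\le b\le c\le d$ be integers such that $\Gamma(a,b,c,d)$ is a simple graph. If $d\geq a+b+c+3$, then $\Gamma(a,b,c,d)$ has avoidance index $1$.
   Context: For integers $0\le a\le b\le c\le d$, $\Gamma(a,b,c,d)$ is the graph consisting of two vertices $u,v$ (each of valency 4) joined by four internally vertex-disjoint paths A, B, C, D having respectively $a,b,c,d$ internal vertices (all of valency 2). Graphs are simple. An Eulerian circuit is a closed trail traversing every edge exactly once. For an Eulerian graph with $m$ edges and vertex $x$, two Eulerian circuits $x,v_1,\ldots,v_{m-1},x$ and $x,w_1,\ldots,w_{m-1},x$ are avoiding if for each $1\le i\le m-1$, $v_i\ne w_i$ and $v_i,w_i$ are non-adjacent; a set of Eulerian circuits is mutually avoiding if they are pairwise avoiding. The avoidance index $\mathrm{av}(G)$ of an Eulerian graph $G$ is the largest $k$ such that for every vertex $x$ there is a set of $k$ mutually avoiding Eulerian circuits starting and ending at $x$. -}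

module Defs where

open import Data.Nat using (ℕ; zero; suc; _+_; _≤_; _<_)
open import Data.Fin using (Fin; toℕ; fromℕ; inject₁) renaming (zero to fzero; suc to fsuc)
open import Data.List using (List; []; _∷_; _++_; length; lookup)
open import Data.Product using (Σ; _×_; _,_; proj₁; proj₂; ∃)
open import Data.Sum using (_⊎_)
open import Relation.Binary.PropositionalEquality using (_≡_; _≢_)
open import Relation.Nullary using (¬_)
open import Function.Definitions using (Injective)

-- A finite multigraph: vertices are the naturals 0 .. nV-1, edges are indexed
-- by Fin m, each edge has an (unordered, stored as an ordered pair) pair of ends.
record Graph : Set where
  field
    nV   : ℕ
    m    : ℕ
    ends : Fin m → ℕ × ℕ
open Graph public

Joins : (G : Graph) → Fin (m G) → ℕ → ℕ → Set
Joins G e x y = (ends G e ≡ (x , y)) ⊎ (ends G e ≡ (y , x))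

Adjacent : Graph → ℕ → ℕ → Set
Adjacent G x y = ∃ λ e → Joins G e x y

IsSimple : Graph → Set
IsSimple G =
  (∀ e → proj₁ (ends G e) < nV G × proj₂ (ends G e) < nV G)
  × (∀ e → proj₁ (ends G e) ≢ proj₂ (ends G e))
  × (∀ e e' → e ≢ e' → ¬ Joins G e' (proj₁ (ends G e)) (proj₂ (ends G e)))

-- An Eulerian circuit starting and ending at x: a closed walk
-- x = vs 0, vs 1, ..., vs m = x whose i-th step uses edge es i,
-- where es is injective (hence every edge is traversed exactly once).
record EulerCircuit (G : Graph) (x : ℕ) : Set where
  field
    vs    : Fin (suc (m G)) → ℕ
    es    : Fin (m G) → Fin (m G)
    inj   : Injective _≡_ _≡_ es
    start : vs fzero ≡ x
    end   : vs (fromℕ (m G)) ≡ x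
    step  : ∀ i → Joins G (es i) (vs (inject₁ i)) (vs (fsuc i))
open EulerCircuit public

Avoiding : {G : Graph} {x : ℕ} → EulerCircuit G x → EulerCircuit G x → Set
Avoiding {G} C D = ∀ (i : Fin (suc (m G))) → 0 < toℕ i → toℕ i < m G →
  (vs C i ≢ vs D i) × ¬ Adjacent G (vs C i) (vs D i)

HasAvoidingFamily : (G : Graph) → ℕ → ℕ → Set
HasAvoidingFamily G k x =
  Σ (Fin k → EulerCircuit G x) λ C → ∀ i j → i ≢ j → Avoiding (C i) (C j)

AllVerticesHave : Graph → ℕ → Set
AllVerticesHave G k = ∀ x → x < nV G → HasAvoidingFamily G k x

AvoidanceIndex : Graph → ℕ → Set
AvoidanceIndex G k = AllVerticesHave G k × (∀ k' → AllVerticesHave G k' → k' ≤ k)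

-- Γ(a,b,c,d): u = 0, v = 1; a path with L internal vertices numbered
-- s, s+1, ..., s+L-1 is u - s - ... - (s+L-1) - v (or the edge u - v if L = 0).
chain : ℕ → ℕ → List (ℕ × ℕ)
chain s zero    = (s , 1) ∷ []
chain s (suc L) = (s , suc s) ∷ chain (suc s) L

pathEdges : ℕ → ℕ → List (ℕ × ℕ)
pathEdges s zero    = (0 , 1) ∷ []
pathEdges s (suc L) = (0 , s) ∷ chain s L

ΓEdges : ℕ → ℕ → ℕ → ℕ → List (ℕ × ℕ)
ΓEdges a b c d =
  pathEdges 2 a ++ pathEdges (2 + a) b ++ pathEdges (2 + a + b) c
    ++ pathEdges (2 + a + b + c) d

Γ : ℕ → ℕ → ℕ → ℕ → Graph
Γ a b c d = record
  { nV   = 2 + a + b + c + d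
  ; m    = length (ΓEdges a b c d)
  ; ends = lookup (ΓEdges a b c d)
  }

module Submission where

-- Following A forwards, B backwards, C forwards and D backwards is an Euler
-- circuit of Γ(a,b,c,d), and rotating it gives one at every vertex, so av ≥ 1.
-- For av ≤ 1 look at the first internal vertex s of D. An Euler circuit at s
-- leaves either along D or towards u; two avoiding circuits differ at time 1,
-- so one of them, Q, leaves along D and the other, P, returns along D. As the
-- internal vertices of D have degree 2, Q walks along D for d steps and so does
-- P backwards, hence Q at time t is P at time m - t for 1 ≤ t ≤ d, where
-- m = a + b + c + 4 + d ≤ 2d + 1 is the number of edges. So at time ⌊m/2⌋ ≤ d
-- the two circuits are at the same vertex (m even) or at the two ends of an
-- edge of P (m odd).

open import Defs
open import Data.Nat using (ℕ; zero; suc; _+_; _∸_; _≤_; _<_; _<?_; z≤n; s≤s; z<s; NonZero; >-nonZero)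
open import Data.Nat.Properties
open import Data.Nat.DivMod using (_%_; m%n<n; m<n⇒m%n≡m; n%n≡0; [m+n]%n≡m%n; %-distribˡ-+; m%n%n≡m%n)
open import Data.Fin using (Fin; toℕ; fromℕ; fromℕ<; inject₁) renaming (zero to fzero; suc to fsuc)
open import Data.Fin.Properties using (toℕ-injective; toℕ-fromℕ<; toℕ-inject₁; toℕ<n; toℕ-fromℕ; fromℕ<-toℕ; fromℕ<-cong)
open import Data.List using (List; []; _∷_; _++_; length; lookup)
open import Data.List.Properties using (length-++; length-++-≤ˡ; ++-assoc)
open import Data.List.Relation.Unary.All using (All; []; _∷_)
open import Data.List.Relation.Unary.All.Properties using (++⁺)
open import Data.Product using (_×_; _,_; proj₁; proj₂; ∃)
open import Data.Sum using (_⊎_; inj₁; inj₂)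
open import Data.Empty using (⊥; ⊥-elim)
open import Function using (_∘_)
open import Relation.Binary.PropositionalEquality
open import Relation.Nullary using (¬_; yes; no)
open import Data.Nat.Tactic.RingSolver using (solve-∀)

open ≡-Reasoning

<-+-split : ∀ m {n t} → t < m + n → t < m ⊎ ∃ λ j → j < n × t ≡ m + j
<-+-split m {n} {t} t<m+n with t <? m
... | yes t<m = inj₁ t<m
... | no  t≮m = inj₂ (t ∸ m , +-cancelˡ-< m _ _ (subst (_< m + n) (sym m+[t∸m]≡t) t<m+n) ,
                    sym m+[t∸m]≡t)
  where m+[t∸m]≡t = m+[n∸m]≡n (≮⇒≥ t≮m)

[m+n%d]%d≡[m+n]%d : ∀ m n d .{{_ : NonZero d}} → (m + n % d) % d ≡ (m + n) % d
[m+n%d]%d≡[m+n]%d m n d = begin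
  (m + n % d) % d             ≡⟨ %-distribˡ-+ m (n % d) d ⟩
  (m % d + n % d % d) % d     ≡⟨ cong (λ k → (m % d + k) % d) (m%n%n≡m%n n d) ⟩
  (m % d + n % d) % d         ≡⟨ %-distribˡ-+ m n d ⟨
  (m + n) % d                 ∎

+-%-injective : ∀ {M} .{{_ : NonZero M}} {r i j} → r ≤ M → i < M → j < M →
  (i + r) % M ≡ (j + r) % M → i ≡ j
+-%-injective {M} {r} {i} {j} r≤M i<M j<M eq = begin
  i                            ≡⟨ unshift i<M ⟨
  (M ∸ r + (i + r) % M) % M    ≡⟨ cong (λ k → (M ∸ r + k) % M) eq ⟩
  (M ∸ r + (j + r) % M) % M    ≡⟨ unshift j<M ⟩
  j                            ∎
  where
  unshift : ∀ {k} → k < M → (M ∸ r + (k + r) % M) % M ≡ k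
  unshift {k} k<M = begin
    (M ∸ r + (k + r) % M) % M  ≡⟨ [m+n%d]%d≡[m+n]%d (M ∸ r) (k + r) M ⟩
    (M ∸ r + (k + r)) % M      ≡⟨ cong (_% M) (begin
      M ∸ r + (k + r)            ≡⟨ cong (M ∸ r +_) (+-comm k r) ⟩
      M ∸ r + (r + k)            ≡⟨ +-assoc (M ∸ r) r k ⟨
      M ∸ r + r + k              ≡⟨ cong (_+ k) (m∸n+n≡m r≤M) ⟩
      M + k                      ≡⟨ +-comm M k ⟩
      k + M                      ∎) ⟩
    (k + M) % M                ≡⟨ [m+n]%n≡m%n k M ⟩
    k % M                      ≡⟨ m<n⇒m%n≡m k<M ⟩
    k                          ∎

1+a+[1+b+1+c]≡a+b+c+3 : ∀ a b c → suc a + (suc b + suc c) ≡ a + b + c + 3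
1+a+[1+b+1+c]≡a+b+c+3 = solve-∀

k+k≤1+h+h⇒k≤h : ∀ {k h} → k + k ≤ suc (h + h) → k ≤ h
k+k≤1+h+h⇒k≤h {zero}          _ = z≤n
k+k≤1+h+h⇒k≤h {suc k} {zero}  p =
  ⊥-elim (<⇒≢ z<s (sym (n≤0⇒n≡0 (subst (_≤ 0) (+-suc k k) (≤-pred p)))))
k+k≤1+h+h⇒k≤h {suc k} {suc h} p =
  s≤s (k+k≤1+h+h⇒k≤h (≤-pred (subst₂ _≤_ (+-suc k k) (cong suc (+-suc h h)) (≤-pred p))))

2≤1+k+k⇒0<k : ∀ {k} → 2 ≤ suc (k + k) → 0 < k
2≤1+k+k⇒0<k {zero}  (s≤s ())
2≤1+k+k⇒0<k {suc k} _ = z<s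

halve : ∀ n → ∃ λ k → n ≡ k + k ⊎ n ≡ suc (k + k)
halve zero = 0 , inj₁ refl
halve (suc n) with halve n
... | k , inj₁ n≡2k = k , inj₂ (cong suc n≡2k)
... | k , inj₂ n≡1+2k = suc k , inj₁ (cong suc (trans n≡1+2k (sym (+-suc k k))))

at : List (ℕ × ℕ) → ℕ → ℕ × ℕ
at []       _       = (0 , 0)
at (p ∷ ps) zero    = p
at (p ∷ ps) (suc n) = at ps n

lookup≡at : ∀ ps (i : Fin (length ps)) → lookup ps i ≡ at ps (toℕ i)
lookup≡at (p ∷ ps) fzero    = refl
lookup≡at (p ∷ ps) (fsuc i) = lookup≡at ps i

at-++ˡ : ∀ ps qs {n} → n < length ps → at (ps ++ qs) n ≡ at ps n
at-++ˡ (p ∷ ps) qs {zero}  _         = refl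
at-++ˡ (p ∷ ps) qs {suc n} (s≤s n<) = at-++ˡ ps qs n<

at-++ʳ : ∀ ps qs n → at (ps ++ qs) (length ps + n) ≡ at qs n
at-++ʳ []       qs n = refl
at-++ʳ (p ∷ ps) qs n = at-++ʳ ps qs n

All-at : ∀ {P : ℕ × ℕ → Set} {ps n} → All P ps → n < length ps → P (at ps n)
All-at {n = zero}  (px ∷ _)   _        = px
All-at {n = suc n} (_  ∷ pxs) (s≤s n<) = All-at pxs n<

Links : ℕ × ℕ → ℕ → ℕ → Set
Links p x y = (p ≡ (x , y)) ⊎ (p ≡ (y , x))

Links-sym : ∀ {p x y} → Links p x y → Links p y x
Links-sym (inj₁ e) = inj₂ e
Links-sym (inj₂ e) = inj₁ e

Links-cong : ∀ {p p′ x x′ y y′} → p ≡ p′ → x ≡ x′ → y ≡ y′ → Links p x y → Links p′ x′ y′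
Links-cong refl refl refl l = l

Linked : List (ℕ × ℕ) → ℕ → ℕ → Set
Linked E x y = ∃ λ n → n < length E × Links (at E n) x y

-- Time runs over 0 … length E; injectivity of edge on [0, length E) makes the
-- trail use every edge of E exactly once.
record EulerTrail (E : List (ℕ × ℕ)) (x y : ℕ) : Set where
  field
    vertex         : ℕ → ℕ
    edge           : ℕ → ℕ
    edge-<         : ∀ {i} → i < length E → edge i < length E
    edge-injective : ∀ {i j} → i < length E → j < length E → edge i ≡ edge j → i ≡ j
    vertex-0       : vertex 0 ≡ x
    vertex-end     : vertex (length E) ≡ y
    link           : ∀ {i} → i < length E → Links (at E (edge i)) (vertex i) (vertex (suc i))
open EulerTrail

record Visits {E x y} (T : EulerTrail E x y) (v : ℕ) : Set where
  field
    time         : ℕ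
    time-≤       : time ≤ length E
    vertex-time  : vertex T time ≡ v
open Visits

visits-start : ∀ {E x y} (T : EulerTrail E x y) → Visits T x
visits-start T = record { time = 0 ; time-≤ = z≤n ; vertex-time = vertex-0 T }

module _ {E : List (ℕ × ℕ)} where

  private
    M = length E

    suc[M∸suc]≡M∸ : ∀ {i} → i < M → suc (M ∸ suc i) ≡ M ∸ i
    suc[M∸suc]≡M∸ i<M = sym (+-∸-assoc 1 i<M)

    M∸suc< : ∀ {i} → i < M → M ∸ suc i < M
    M∸suc< = ∸-monoʳ-< z<s

  reverse : ∀ {x y} → EulerTrail E x y → EulerTrail E y x
  reverse T = record
    { vertex         = λ i → vertex T (M ∸ i)
    ; edge           = λ i → edge T (M ∸ suc i)
    ; edge-<         = λ i<M → edge-< T (M∸suc< i<M)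
    ; edge-injective = λ i<M j<M e →
        suc-injective (∸-cancelˡ-≡ i<M j<M (edge-injective T (M∸suc< i<M) (M∸suc< j<M) e))
    ; vertex-0       = vertex-end T
    ; vertex-end     = trans (cong (vertex T) (n∸n≡0 M)) (vertex-0 T)
    ; link           = λ i<M →
        Links-sym (Links-cong refl refl (cong (vertex T) (suc[M∸suc]≡M∸ i<M)) (link T (M∸suc< i<M)))
    }

  visits-reverse : ∀ {x y} {T : EulerTrail E x y} {v} → Visits T v → Visits (reverse T) v
  visits-reverse {T = T} V = record
    { time        = M ∸ time V
    ; time-≤      = m∸n≤m M (time V)
    ; vertex-time = trans (cong (vertex T) (m∸[m∸n]≡n (time-≤ V))) (vertex-time V)
    }

glue : ℕ → (ℕ → ℕ) → (ℕ → ℕ) → ℕ → ℕ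
glue m f g t with t <? m
... | yes _ = f t
... | no  _ = g (t ∸ m)

glue-< : ∀ {m} f g {t} → t < m → glue m f g t ≡ f t
glue-< {m} f g {t} t<m with t <? m
... | yes _   = refl
... | no  t≮m = ⊥-elim (t≮m t<m)

glue-+ : ∀ m f g j → glue m f g (m + j) ≡ g j
glue-+ m f g j with m + j <? m
... | yes m+j<m = ⊥-elim (m+n≮m m j m+j<m)
... | no  _     = cong g (m+n∸m≡n m j)

glue-≤ : ∀ {m} f g {t} → f m ≡ g 0 → t ≤ m → glue m f g t ≡ f t
glue-≤ {m} f g {t} fm≡g0 t≤m with m≤n⇒m<n∨m≡n t≤m
... | inj₁ t<m  = glue-< f g t<m
... | inj₂ refl = trans (cong (glue m f g) (sym (+-identityʳ m))) (trans (glue-+ m f g 0) (sym fm≡g0))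

module _ {xs ys : List (ℕ × ℕ)} {x y z : ℕ} (T₁ : EulerTrail xs x y) (T₂ : EulerTrail ys y z) where

  private
    m₁ = length xs
    m₂ = length ys

    split : ∀ {t} → t < length (xs ++ ys) → t < m₁ ⊎ ∃ λ j → j < m₂ × t ≡ m₁ + j
    split t< = <-+-split m₁ (subst (_ <_) (length-++ xs) t<)

    junction : vertex T₁ m₁ ≡ vertex T₂ 0
    junction = trans (vertex-end T₁) (sym (vertex-0 T₂))

    V = glue m₁ (vertex T₁) (vertex T₂)
    e = glue m₁ (edge T₁) (λ j → m₁ + edge T₂ j)

    e-< : ∀ {t} → t < length (xs ++ ys) → e t < length (xs ++ ys)
    e-< t< with split t<
    ... | inj₁ t<m₁ =
      subst (_< _) (sym (glue-< _ _ t<m₁)) (≤-trans (edge-< T₁ t<m₁) (length-++-≤ˡ xs))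
    ... | inj₂ (j , j<m₂ , refl) =
      subst₂ _<_ (sym (glue-+ m₁ _ _ j)) (sym (length-++ xs)) (+-monoʳ-< m₁ (edge-< T₂ j<m₂))

    e-injective : ∀ {i j} → i < length (xs ++ ys) → j < length (xs ++ ys) → e i ≡ e j → i ≡ j
    e-injective i< j< eq with split i< | split j<
    ... | inj₁ i<m₁ | inj₁ j<m₁ =
      edge-injective T₁ i<m₁ j<m₁ (trans (sym (glue-< _ _ i<m₁)) (trans eq (glue-< _ _ j<m₁)))
    ... | inj₂ (i′ , i′<m₂ , refl) | inj₂ (j′ , j′<m₂ , refl) =
      cong (m₁ +_) (edge-injective T₂ i′<m₂ j′<m₂
        (+-cancelˡ-≡ m₁ _ _ (trans (sym (glue-+ m₁ _ _ i′)) (trans eq (glue-+ m₁ _ _ j′)))))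
    ... | inj₁ i<m₁ | inj₂ (j′ , _ , refl) =
      ⊥-elim (m+n≮m m₁ _ (subst (_< m₁) (trans (sym (glue-< _ _ i<m₁)) (trans eq (glue-+ m₁ _ _ j′)))
                                         (edge-< T₁ i<m₁)))
    ... | inj₂ (i′ , _ , refl) | inj₁ j<m₁ =
      ⊥-elim (m+n≮m m₁ _ (subst (_< m₁) (trans (sym (glue-< _ _ j<m₁)) (trans (sym eq) (glue-+ m₁ _ _ i′)))
                                         (edge-< T₁ j<m₁)))

    V-end : V (length (xs ++ ys)) ≡ z
    V-end = trans (cong V (length-++ xs)) (trans (glue-+ m₁ _ _ m₂) (vertex-end T₂))

    V-link : ∀ {t} → t < length (xs ++ ys) → Links (at (xs ++ ys) (e t)) (V t) (V (suc t))
    V-link t< with split t<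
    ... | inj₁ t<m₁ = Links-cong
      (sym (trans (cong (at (xs ++ ys)) (glue-< _ _ t<m₁)) (at-++ˡ xs ys (edge-< T₁ t<m₁))))
      (sym (glue-< _ _ t<m₁)) (sym (glue-≤ _ _ junction t<m₁)) (link T₁ t<m₁)
    ... | inj₂ (j , j<m₂ , refl) = Links-cong
      (sym (trans (cong (at (xs ++ ys)) (glue-+ m₁ _ _ j)) (at-++ʳ xs ys (edge T₂ j))))
      (sym (glue-+ m₁ _ _ j))
      (sym (trans (cong V (sym (+-suc m₁ j))) (glue-+ m₁ _ _ (suc j))))
      (link T₂ j<m₂)

  _++ᵗ_ : EulerTrail (xs ++ ys) x z
  _++ᵗ_ = record
    { vertex         = V
    ; edge           = e
    ; edge-<         = e-<
    ; edge-injective = e-injective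
    ; vertex-0       = trans (glue-≤ (vertex T₁) (vertex T₂) junction z≤n) (vertex-0 T₁)
    ; vertex-end     = V-end
    ; link           = V-link
    }

  visits-++ˡ : ∀ {v} → Visits T₁ v → Visits _++ᵗ_ v
  visits-++ˡ W = record
    { time        = time W
    ; time-≤      = ≤-trans (time-≤ W) (length-++-≤ˡ xs)
    ; vertex-time = trans (glue-≤ (vertex T₁) (vertex T₂) junction (time-≤ W)) (vertex-time W)
    }

  visits-++ʳ : ∀ {v} → Visits T₂ v → Visits _++ᵗ_ v
  visits-++ʳ W = record
    { time        = m₁ + time W
    ; time-≤      = subst (m₁ + time W ≤_) (sym (length-++ xs)) (+-monoʳ-≤ m₁ (time-≤ W))
    ; vertex-time = trans (glue-+ m₁ _ _ (time W)) (vertex-time W)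
    }

module _ {E : List (ℕ × ℕ)} {x : ℕ} (C : EulerTrail E x x) .{{_ : NonZero (length E)}} where

  private
    M = length E

  vertex-% : ∀ {t} → t ≤ M → vertex C (t % M) ≡ vertex C t
  vertex-% t≤M with m≤n⇒m<n∨m≡n t≤M
  ... | inj₁ t<M  = cong (vertex C) (m<n⇒m%n≡m t<M)
  ... | inj₂ refl = trans (cong (vertex C) (n%n≡0 M)) (trans (vertex-0 C) (sym (vertex-end C)))

  rotate : ∀ {r} → r ≤ M → EulerTrail E (vertex C r) (vertex C r)
  rotate {r} r≤M = record
    { vertex         = λ i → vertex C ((i + r) % M)
    ; edge           = λ i → edge C ((i + r) % M)
    ; edge-<         = λ _ → edge-< C (m%n<n _ M)
    ; edge-injective = λ i<M j<M e →
        +-%-injective r≤M i<M j<M (edge-injective C (m%n<n _ M) (m%n<n _ M) e)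
    ; vertex-0       = vertex-% r≤M
    ; vertex-end     = trans (cong (λ k → vertex C (k % M)) (+-comm M r))
                         (trans (cong (vertex C) ([m+n]%n≡m%n r M)) (vertex-% r≤M))
    ; link           = λ {i} _ → Links-cong refl refl (next i) (link C (m%n<n (i + r) M))
    }
    where
    next : ∀ i → vertex C (suc ((i + r) % M)) ≡ vertex C ((suc i + r) % M)
    next i = trans (sym (vertex-% (m%n<n (i + r) M))) (cong (vertex C) ([m+n%d]%d≡[m+n]%d 1 (i + r) M))

  circuit-from-visit : ∀ {v} → Visits C v → EulerTrail E v v
  circuit-from-visit W = subst (λ u → EulerTrail E u u) (vertex-time W) (rotate (time-≤ W))

Clash : ∀ {E x y x′ y′} → EulerTrail E x y → EulerTrail E x′ y′ → Set
Clash {E} P Q = ∃ λ t → 0 < t × t < length E ×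
  (vertex P t ≡ vertex Q t ⊎ Linked E (vertex P t) (vertex Q t))

Clash-sym : ∀ {E x y x′ y′} {P : EulerTrail E x y} {Q : EulerTrail E x′ y′} → Clash P Q → Clash Q P
Clash-sym (t , 0<t , t<M , inj₁ e)             = t , 0<t , t<M , inj₁ (sym e)
Clash-sym (t , 0<t , t<M , inj₂ (n , n<M , l)) = t , 0<t , t<M , inj₂ (n , n<M , Links-sym l)

-- The clash happens at time ⌊length E / 2⌋.
clash-of-mirror : ∀ {E x y x′ y′} (P : EulerTrail E x y) (Q : EulerTrail E x′ y′) {h} →
  2 ≤ length E → length E ≤ suc (h + h) →
  (∀ {t} → 0 < t → t ≤ h → vertex Q t ≡ vertex P (length E ∸ t)) → Clash P Q
clash-of-mirror {E} P Q {h} 2≤M M≤1+h+h mirror with halve (length E)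
... | k , inj₁ M≡k+k = k , 0<k , k<M , inj₁ (sym (trans (mirror 0<k k≤h) (cong (vertex P) M∸k≡k)))
  where
  0<k   = 2≤1+k+k⇒0<k (≤-trans 2≤M (≤-trans (≤-reflexive M≡k+k) (n≤1+n _)))
  k≤h   = k+k≤1+h+h⇒k≤h (subst (_≤ _) M≡k+k M≤1+h+h)
  k<M   = subst (k <_) (sym M≡k+k) (m<m+n k 0<k)
  M∸k≡k = trans (cong (_∸ k) M≡k+k) (m+n∸n≡m k k)
... | k , inj₂ M≡1+k+k =
  k , 0<k , k<M , inj₂ (edge P k , edge-< P k<M , Links-cong refl refl Pk+1≡Qk (link P k<M))
  where
  0<k     = 2≤1+k+k⇒0<k (subst (2 ≤_) M≡1+k+k 2≤M)
  k≤h     = k+k≤1+h+h⇒k≤h (≤-trans (n≤1+n _) (subst (_≤ _) M≡1+k+k M≤1+h+h))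
  k<M     = subst (k <_) (sym M≡1+k+k) (s≤s (m≤m+n k k))
  Pk+1≡Qk =
    sym (trans (mirror 0<k k≤h) (cong (vertex P) (trans (cong (_∸ k) M≡1+k+k) (m+n∸n≡m (suc k) k))))

-- Γ a b c d is definitionally graphOf (2 + a + b + c + d) (ΓEdges a b c d).
graphOf : ℕ → List (ℕ × ℕ) → Graph
graphOf n E = record { nV = n ; m = length E ; ends = lookup E }

extend : ∀ {n} → (Fin n → ℕ) → ℕ → ℕ
extend {n} f t with t <? n
... | yes t<n = f (fromℕ< t<n)
... | no  _   = 0

extend-fromℕ< : ∀ {n} (f : Fin n → ℕ) {t} (t<n : t < n) → extend f t ≡ f (fromℕ< t<n)
extend-fromℕ< {n} f {t} t<n with t <? n
... | yes t<n′ = cong f (fromℕ<-cong t t refl t<n′ t<n)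
... | no  t≮n  = ⊥-elim (t≮n t<n)

extend-toℕ : ∀ {n} (f : Fin n → ℕ) (i : Fin n) → extend f (toℕ i) ≡ f i
extend-toℕ f i = trans (extend-fromℕ< f (toℕ<n i)) (cong f (fromℕ<-toℕ i (toℕ<n i)))

module _ {n : ℕ} {E : List (ℕ × ℕ)} {x : ℕ} where

  private
    M = length E

  toEulerCircuit : EulerTrail E x x → EulerCircuit (graphOf n E) x
  toEulerCircuit T = record
    { vs    = λ i → vertex T (toℕ i)
    ; es    = λ i → fromℕ< (edge-< T (toℕ<n i))
    ; inj   = λ {i} {j} e → toℕ-injective (edge-injective T (toℕ<n i) (toℕ<n j) (begin
        edge T (toℕ i)                     ≡⟨ toℕ-fromℕ< (edge-< T (toℕ<n i)) ⟨
        toℕ (fromℕ< (edge-< T (toℕ<n i)))  ≡⟨ cong toℕ e ⟩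
        toℕ (fromℕ< (edge-< T (toℕ<n j)))  ≡⟨ toℕ-fromℕ< (edge-< T (toℕ<n j)) ⟩
        edge T (toℕ j)                     ∎))
    ; start = vertex-0 T
    ; end   = trans (cong (vertex T) (toℕ-fromℕ M)) (vertex-end T)
    ; step  = λ i → Links-cong
        (sym (trans (lookup≡at E _) (cong (at E) (toℕ-fromℕ< (edge-< T (toℕ<n i))))))
        (cong (vertex T) (sym (toℕ-inject₁ i))) refl (link T (toℕ<n i))
    }

  fromEulerCircuit : EulerCircuit (graphOf n E) x → EulerTrail E x x
  fromEulerCircuit C = record
    { vertex         = V
    ; edge           = e
    ; edge-<         = λ t<M → subst (_< M) (sym (extend-fromℕ< _ t<M)) (toℕ<n _)
    ; edge-injective = e-injective
    ; vertex-0       = trans (extend-fromℕ< (vs C) z<s) (start C)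
    ; vertex-end     = trans (cong V (sym (toℕ-fromℕ M))) (trans (extend-toℕ (vs C) (fromℕ M)) (end C))
    ; link           = λ t<M →
        subst (λ t → Links (at E (e t)) (V t) (V (suc t))) (toℕ-fromℕ< t<M) (link-toℕ (fromℕ< t<M))
    }
    where
    V = extend (vs C)
    e = extend (toℕ ∘ es C)

    e-injective : ∀ {i j} → i < M → j < M → e i ≡ e j → i ≡ j
    e-injective {i} {j} i<M j<M eq = begin
      i                 ≡⟨ toℕ-fromℕ< i<M ⟨
      toℕ (fromℕ< i<M)  ≡⟨ cong toℕ (inj C (toℕ-injective
                             (trans (sym (extend-fromℕ< _ i<M)) (trans eq (extend-fromℕ< _ j<M))))) ⟩
      toℕ (fromℕ< j<M)  ≡⟨ toℕ-fromℕ< j<M ⟩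
      j                 ∎

    link-toℕ : ∀ i → Links (at E (e (toℕ i))) (V (toℕ i)) (V (suc (toℕ i)))
    link-toℕ i = Links-cong
      (trans (lookup≡at E (es C i)) (cong (at E) (sym (extend-toℕ (toℕ ∘ es C) i))))
      (trans (sym (extend-toℕ (vs C) (inject₁ i))) (cong V (toℕ-inject₁ i)))
      (sym (extend-toℕ (vs C) (fsuc i)))
      (step C i)

  Linked⇒Adjacent : ∀ {u v} → Linked E u v → Adjacent (graphOf n E) u v
  Linked⇒Adjacent (k , k<M , l) =
    fromℕ< k<M , Links-cong (sym (trans (lookup≡at E _) (cong (at E) (toℕ-fromℕ< k<M)))) refl refl l

  Clash⇒¬Avoiding : (P Q : EulerCircuit (graphOf n E) x) →
    Clash (fromEulerCircuit P) (fromEulerCircuit Q) → ¬ Avoiding P Q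
  Clash⇒¬Avoiding P Q (t , 0<t , t<M , clash) avoiding =
    refute (avoiding i (subst (0 <_) (sym toℕi≡t) 0<t) (subst (_< M) (sym toℕi≡t) t<M)) clash
    where
    t<1+M  = m≤n⇒m≤1+n t<M
    i      = fromℕ< t<1+M
    toℕi≡t = toℕ-fromℕ< t<1+M
    Pt≡Pi  = extend-fromℕ< (vs P) t<1+M
    Qt≡Qi  = extend-fromℕ< (vs Q) t<1+M

    refute : (vs P i ≢ vs Q i) × ¬ Adjacent (graphOf n E) (vs P i) (vs Q i) →
      extend (vs P) t ≡ extend (vs Q) t ⊎ Linked E (extend (vs P) t) (extend (vs Q) t) → ⊥
    refute (Pi≢Qi , _)      (inj₁ Pt≡Qt) = Pi≢Qi (trans (sym Pt≡Pi) (trans Pt≡Qt Qt≡Qi))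
    refute (_ , ¬adjacent) (inj₂ linked) =
      ¬adjacent (subst₂ (Adjacent (graphOf n E)) Pt≡Pi Qt≡Qi (Linked⇒Adjacent linked))

avoidanceIndex-1 : ∀ {G x₀} → x₀ < nV G → (∀ x → x < nV G → EulerCircuit G x) →
  ((P Q : EulerCircuit G x₀) → ¬ Avoiding P Q) → AvoidanceIndex G 1
avoidanceIndex-1 {G} {x₀} x₀<n circuit no-pair = one , at-most-one
  where
  one : AllVerticesHave G 1
  one x x<n = (λ _ → circuit x x<n) , λ { fzero fzero 0≢0 → ⊥-elim (0≢0 refl) }

  at-most-one : ∀ k → AllVerticesHave G k → k ≤ 1
  at-most-one zero          _    = z≤n
  at-most-one (suc zero)    _    = ≤-refl
  at-most-one (suc (suc k)) have with have x₀ x₀<n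
  ... | C , avoiding = ⊥-elim (no-pair (C fzero) (C (fsuc fzero)) (avoiding fzero (fsuc fzero) λ ()))

-- The k-th vertex of the walk 0, S, S+1, …, S+L-1, 1 along pathEdges S L
-- (with junk value 1 after its end).
pathVertex : ℕ → ℕ → ℕ → ℕ
pathVertex S L       zero          = 0
pathVertex S zero    (suc k)       = 1
pathVertex S (suc L) (suc zero)    = S
pathVertex S (suc L) (suc (suc k)) = pathVertex (suc S) L (suc k)

pathVertex-inner : ∀ S {L k} → k < L → pathVertex S L (suc k) ≡ S + k
pathVertex-inner S {suc L} {zero}  _        = sym (+-identityʳ S)
pathVertex-inner S {suc L} {suc k} (s≤s k<L) = trans (pathVertex-inner (suc S) k<L) (sym (+-suc S k))

pathVertex-outer : ∀ S {L k} → L ≤ k → pathVertex S L (suc k) ≡ 1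
pathVertex-outer S {zero}          _         = refl
pathVertex-outer S {suc L} {suc k} (s≤s L≤k) = pathVertex-outer (suc S) L≤k

pathVertex-injective : ∀ {S L j k} → 2 ≤ S → pathVertex S L j ≡ S + k → j ≡ suc k
pathVertex-injective {S} {L} {zero}  {k} 2≤S eq =
  ⊥-elim (<⇒≢ (≤-trans z<s (≤-trans 2≤S (m≤m+n S k))) eq)
pathVertex-injective {S} {L} {suc i} {k} 2≤S eq with i <? L
... | yes i<L = cong suc (+-cancelˡ-≡ S i k (trans (sym (pathVertex-inner S i<L)) eq))
... | no  i≮L =
  ⊥-elim (<⇒≢ (≤-trans 2≤S (m≤m+n S k)) (trans (sym (pathVertex-outer S (≮⇒≥ i≮L))) eq))

at-chain : ∀ S L {k} → k ≤ L →
  at (chain S L) k ≡ (pathVertex S (suc L) (suc k) , pathVertex S (suc L) (suc (suc k)))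
at-chain S zero    {zero}  _        = refl
at-chain S (suc L) {zero}  _        = refl
at-chain S (suc L) {suc k} (s≤s k≤L) = at-chain (suc S) L k≤L

at-pathEdges : ∀ S L {k} → k ≤ L → at (pathEdges S L) k ≡ (pathVertex S L k , pathVertex S L (suc k))
at-pathEdges S zero    {zero}  _         = refl
at-pathEdges S (suc L) {zero}  _         = refl
at-pathEdges S (suc L) {suc k} (s≤s k≤L) = at-chain S L k≤L

length-chain : ∀ S L → length (chain S L) ≡ suc L
length-chain S zero    = refl
length-chain S (suc L) = cong suc (length-chain (suc S) L)

length-pathEdges : ∀ S L → length (pathEdges S L) ≡ suc L
length-pathEdges S zero    = refl
length-pathEdges S (suc L) = cong suc (length-chain S L)

pathTrail : ∀ S L → EulerTrail (pathEdges S L) 0 1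
pathTrail S L = record
  { vertex         = pathVertex S L
  ; edge           = λ k → k
  ; edge-<         = λ k< → k<
  ; edge-injective = λ _ _ e → e
  ; vertex-0       = refl
  ; vertex-end     = trans (cong (pathVertex S L) (length-pathEdges S L)) (pathVertex-outer S {L} ≤-refl)
  ; link           = λ k< → inj₁ (at-pathEdges S L (≤-pred (subst (_ <_) (length-pathEdges S L) k<)))
  }

pathTrail-visits : ∀ S {L i} → i < L → Visits (pathTrail S L) (S + i)
pathTrail-visits S {L} i<L = record
  { time        = suc _
  ; time-≤      = subst (_ ≤_) (sym (length-pathEdges S L)) (m≤n⇒m≤1+n i<L)
  ; vertex-time = pathVertex-inner S i<L
  }

pathEdges-incident : ∀ {S L j k y} → 2 ≤ S → j ≤ L → Links (at (pathEdges S L) j) (S + k) y →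
  (j ≡ k × y ≡ pathVertex S L k) ⊎ (j ≡ suc k × y ≡ pathVertex S L (suc (suc k)))
pathEdges-incident {S} {L} {j} {k} 2≤S j≤L l with Links-cong (at-pathEdges S L j≤L) refl refl l
... | inj₁ e with pathVertex-injective {S} {L} {j} 2≤S (cong proj₁ e)
...   | refl = inj₂ (refl , sym (cong proj₂ e))
pathEdges-incident {S} {L} {j} {k} 2≤S j≤L l | inj₂ e
  with pathVertex-injective {S} {L} {suc j} 2≤S (cong proj₂ e)
...   | refl = inj₁ (refl , sym (cong proj₁ e))

Below : ℕ → ℕ × ℕ → Set
Below t p = proj₁ p < t × proj₂ p < t

chain-below : ∀ {t} S L → 1 < t → S + L < t → All (Below t) (chain S L)
chain-below {t} S zero    1<t S+0<t = (subst (_< t) (+-identityʳ S) S+0<t , 1<t) ∷ []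
chain-below {t} S (suc L) 1<t S+1+L<t =
  (≤-trans (s≤s (m≤m+n S (suc L))) S+1+L<t , ≤-trans (s≤s (m≤m+n (suc S) L)) 1+S+L<t)
  ∷ chain-below (suc S) L 1<t 1+S+L<t
  where 1+S+L<t = subst (_< t) (+-suc S L) S+1+L<t

pathEdges-below : ∀ {t} S L → 1 < t → S + L ≤ t → All (Below t) (pathEdges S L)
pathEdges-below S zero    1<t _       = (<-trans z<s 1<t , 1<t) ∷ []
pathEdges-below {t} S (suc L) 1<t S+1+L≤t =
  (<-trans z<s 1<t , <-≤-trans (m<m+n S z<s) S+1+L≤t)
  ∷ chain-below S L 1<t (subst (_≤ t) (+-suc S L) S+1+L≤t)

Links-below : ∀ {t p k y} → Below t p → ¬ Links p (t + k) y
Links-below (t+k<t , _) (inj₁ refl) = m+n≮m _ _ t+k<t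
Links-below (_ , t+k<t) (inj₂ refl) = m+n≮m _ _ t+k<t

-- The path 0, s, …, s+d-1, 1 hung onto xs: its internal vertices meet no edge
-- of xs, so they have degree 2 in E.
module SuspendedPath (xs : List (ℕ × ℕ)) (s d : ℕ) (2≤s : 2 ≤ s) (xs-below : All (Below s) xs)
                     (0<d : 0 < d) where

  E = xs ++ pathEdges s d
  o = length xs

  length-E : length E ≡ o + suc d
  length-E = trans (length-++ xs) (cong (o +_) (length-pathEdges s d))

  ≤d⇒<M : ∀ {t} → t ≤ d → t < length E
  ≤d⇒<M t≤d = subst (_ <_) (sym length-E) (≤-trans (s≤s t≤d) (m≤n+m (suc d) o))

  2≤M : 2 ≤ length E
  2≤M = ≤d⇒<M 0<d

  incident : ∀ {n k y} → n < length E → Links (at E n) (s + k) y →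
    (n ≡ o + k × y ≡ pathVertex s d k) ⊎ (n ≡ o + suc k × y ≡ pathVertex s d (suc (suc k)))
  incident {n} n<M l with <-+-split o (subst (n <_) length-E n<M)
  ... | inj₁ n<o = ⊥-elim (Links-below (All-at xs-below n<o) (Links-cong (at-++ˡ xs _ n<o) refl refl l))
  ... | inj₂ (j , j≤d , refl)
    with pathEdges-incident 2≤s (≤-pred j≤d) (Links-cong (at-++ʳ xs _ j) refl refl l)
  ...   | inj₁ (refl , y≡) = inj₁ (refl , y≡)
  ...   | inj₂ (refl , y≡) = inj₂ (refl , y≡)

  first-step : ∀ {z} (C : EulerTrail E s z) →
    (edge C 0 ≡ o + 0 × vertex C 1 ≡ 0) ⊎ (edge C 0 ≡ o + 1 × vertex C 1 ≡ pathVertex s d 2)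
  first-step C =
    incident (edge-< C 0<M) (Links-cong refl (trans (vertex-0 C) (sym (+-identityʳ s))) refl (link C 0<M))
    where 0<M = ≤d⇒<M z≤n

  next-along : ∀ {z} (C : EulerTrail E s z) {t k} → t < length E →
    vertex C t ≡ s + k → edge C t ≢ o + k →
    vertex C (suc t) ≡ pathVertex s d (suc (suc k)) × edge C t ≡ o + suc k
  next-along C t<M vt≡ not-back with incident (edge-< C t<M) (Links-cong refl vt≡ refl (link C t<M))
  ... | inj₁ (back , _)    = ⊥-elim (not-back back)
  ... | inj₂ (forward , v) = v , forward

  walks-along : ∀ {z} (C : EulerTrail E s z) → edge C 0 ≡ o + 1 →
    ∀ {t} → t < d → vertex C (suc t) ≡ pathVertex s d (suc (suc t)) × edge C t ≡ o + suc t
  walks-along C e0 {zero} _ =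
    next-along C (≤d⇒<M z≤n) (trans (vertex-0 C) (sym (+-identityʳ s)))
      (λ e → 0≢1+n (+-cancelˡ-≡ o 0 1 (trans (sym e) e0)))
  walks-along C e0 {suc t} t+1<d with walks-along C e0 (<-trans (n<1+n t) t+1<d)
  ... | vt+1 , et = next-along C t+1<M (trans vt+1 (pathVertex-inner s t+1<d))
                      (λ e → 1+n≢n (edge-injective C t+1<M t<M (trans e (sym et))))
    where
    t+1<M = ≤d⇒<M (<⇒≤ t+1<d)
    t<M   = ≤d⇒<M (<⇒≤ (<-trans (n<1+n t) t+1<d))

  reverse-starts-along : (C : EulerTrail E s s) → edge C 0 ≡ o + 0 → edge (reverse C) 0 ≡ o + 1
  reverse-starts-along C e0 with first-step (reverse C)
  ... | inj₂ (e , _) = e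
  ... | inj₁ (e , _) =
    ⊥-elim (<⇒≱ 2≤M (m∸n≡0⇒m≤n (edge-injective C M∸1<M 0<M (trans e (sym e0)))))
    where
    0<M   = ≤d⇒<M z≤n
    M∸1<M = ∸-monoʳ-< z<s 0<M

  clash-of-opposite-starts : (P Q : EulerTrail E s s) → o ≤ d →
    edge P 0 ≡ o + 0 → edge Q 0 ≡ o + 1 → Clash P Q
  clash-of-opposite-starts P Q o≤d P0 Q0 = clash-of-mirror P Q {d} 2≤M M≤1+d+d retraces
    where
    M≤1+d+d : length E ≤ suc (d + d)
    M≤1+d+d = subst₂ _≤_ (sym length-E) (+-suc d d) (+-monoˡ-≤ (suc d) o≤d)

    retraces : ∀ {t} → 0 < t → t ≤ d → vertex Q t ≡ vertex P (length E ∸ t)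
    retraces {suc t} _ t<d =
      trans (proj₁ (walks-along Q Q0 t<d))
            (sym (proj₁ (walks-along (reverse P) (reverse-starts-along P P0) t<d)))

  clash : o ≤ d → (P Q : EulerTrail E s s) → Clash P Q
  clash o≤d P Q with first-step P | first-step Q
  ... | inj₁ (_ , P1) | inj₁ (_ , Q1) = 1 , z<s , 2≤M , inj₁ (trans P1 (sym Q1))
  ... | inj₂ (_ , P1) | inj₂ (_ , Q1) = 1 , z<s , 2≤M , inj₁ (trans P1 (sym Q1))
  ... | inj₁ (P0 , _) | inj₂ (Q0 , _) = clash-of-opposite-starts P Q o≤d P0 Q0
  ... | inj₂ (P0 , _) | inj₁ (Q0 , _) = Clash-sym {P = Q} {Q = P} (clash-of-opposite-starts Q P o≤d Q0 P0)

  no-avoiding : o ≤ d → ∀ {n} (P Q : EulerCircuit (graphOf n E) s) → ¬ Avoiding P Q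
  no-avoiding o≤d P Q =
    Clash⇒¬Avoiding {E = E} P Q (clash o≤d (fromEulerCircuit {E = E} P) (fromEulerCircuit {E = E} Q))

module _ (a b c d : ℕ) where

  private
    A = pathTrail 2 a
    B = reverse (pathTrail (2 + a) b)
    C = pathTrail (2 + a + b) c
    D = reverse (pathTrail (2 + a + b + c) d)

  Γ-trail : EulerTrail (ΓEdges a b c d) 0 0
  Γ-trail = A ++ᵗ (B ++ᵗ (C ++ᵗ D))

  Γ-trail-visits : ∀ {x} → x < 2 + a + b + c + d → Visits Γ-trail x
  Γ-trail-visits {zero}        _ = visits-start Γ-trail
  Γ-trail-visits {suc zero}    _ = visits-++ʳ A _ (visits-++ˡ B _ (visits-start B))
  Γ-trail-visits {suc (suc y)} (s≤s (s≤s y<)) with <-+-split (a + b + c) y<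
  ... | inj₂ (j , j<d , refl) =
    visits-++ʳ A _ (visits-++ʳ B _ (visits-++ʳ C D (visits-reverse (pathTrail-visits _ j<d))))
  ... | inj₁ y<a+b+c with <-+-split (a + b) y<a+b+c
  ...   | inj₂ (j , j<c , refl) =
    visits-++ʳ A _ (visits-++ʳ B _ (visits-++ˡ C D (pathTrail-visits _ j<c)))
  ...   | inj₁ y<a+b with <-+-split a y<a+b
  ...     | inj₂ (j , j<b , refl) =
    visits-++ʳ A _ (visits-++ˡ B _ (visits-reverse (pathTrail-visits _ j<b)))
  ...     | inj₁ y<a = visits-++ˡ A _ (pathTrail-visits 2 y<a)

  Γ-circuit : ∀ x → x < 2 + a + b + c + d → EulerCircuit (Γ a b c d) x
  Γ-circuit x x< = toEulerCircuit (circuit-from-visit Γ-trail {{>-nonZero 0<M}} (Γ-trail-visits x<))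
    where
    0<M : 0 < length (ΓEdges a b c d)
    0<M = <-≤-trans (subst (0 <_) (sym (length-pathEdges 2 a)) z<s) (length-++-≤ˡ (pathEdges 2 a))

  private
    s  = 2 + a + b + c
    xs = pathEdges 2 a ++ pathEdges (2 + a) b ++ pathEdges (2 + a + b) c

    ΓEdges≡ : xs ++ pathEdges s d ≡ ΓEdges a b c d
    ΓEdges≡ = trans (++-assoc (pathEdges 2 a) _ _)
                    (cong (pathEdges 2 a ++_) (++-assoc (pathEdges (2 + a) b) _ _))

    xs-below : All (Below s) xs
    xs-below = ++⁺ (pathEdges-below 2 a 1<s (≤-trans (m≤m+n (2 + a) b) (m≤m+n (2 + a + b) c)))
              (++⁺ (pathEdges-below (2 + a) b 1<s (m≤m+n (2 + a + b) c))
                   (pathEdges-below (2 + a + b) c 1<s ≤-refl))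
      where 1<s = s≤s (s≤s z≤n)

    length-xs : length xs ≡ a + b + c + 3
    length-xs = begin
      length xs                            ≡⟨ length-++ (pathEdges 2 a) ⟩
      length (pathEdges 2 a) + length (pathEdges (2 + a) b ++ pathEdges (2 + a + b) c)
        ≡⟨ cong₂ _+_ (length-pathEdges 2 a) (trans (length-++ (pathEdges (2 + a) b))
                (cong₂ _+_ (length-pathEdges (2 + a) b) (length-pathEdges (2 + a + b) c))) ⟩
      suc a + (suc b + suc c)              ≡⟨ 1+a+[1+b+1+c]≡a+b+c+3 a b c ⟩
      a + b + c + 3                        ∎

  Γ-no-avoiding : a + b + c + 3 ≤ d → (P Q : EulerCircuit (Γ a b c d) s) → ¬ Avoiding P Q
  Γ-no-avoiding d-large =
    subst (λ E → (P Q : EulerCircuit (graphOf (s + d) E) s) → ¬ Avoiding P Q) ΓEdges≡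
    (SuspendedPath.no-avoiding xs s d (s≤s (s≤s z≤n)) xs-below 0<d (subst (_≤ d) (sym length-xs) d-large))
    where 0<d = ≤-trans (s≤s z≤n) (≤-trans (m≤n+m 3 (a + b + c)) d-large)

lemma4 : ∀ (a b c d : ℕ) → a ≤ b → b ≤ c → c ≤ d →
    IsSimple (Γ a b c d) → a + b + c + 3 ≤ d →
    AvoidanceIndex (Γ a b c d) 1
lemma4 a b c d _ _ _ _ d-large =
  avoidanceIndex-1 (m<m+n (2 + a + b + c) 0<d) (Γ-circuit a b c d) (Γ-no-avoiding a b c d d-large)
  where 0<d = ≤-trans (s≤s z≤n) (≤-trans (m≤n+m 3 (a + b + c)) d-large)
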